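{- Let $n\in\mathbb{N}$, $s\le n$, and let $L_1,\ldots,L_s\subseteq[n]$. For any distinct integers $1\le x_1,\ldots,x_s\le n$, a uniformly random permutation $\pi$ of $[n]$ satisfies $$\mathbb{P}\Big[\bigwedge_{i=1}^s \pi(x_i)\in L_i\Big]\le \prod_{i=1}^s \frac{e|L_i|}{n}.$$ -}

module Defs where

open import Data.Nat using (ℕ; zero; suc)
open import Data.Nat using (_!)
open import Data.Fin using (Fin)
open import Data.Fin.Properties using (all?)
open import Data.Fin.Subset using (Subset; _∈_)
open import Data.Fin.Subset.Properties using (_∈?_)
open import Data.Vec using (Vec; []; _∷_; lookup; toList)
open import Data.List using (List; [_]; map; concatMap; allFin; filter; length)
open import Data.List.Relation.Unary.Unique.Propositional using (Unique)
open import Data.Product using (_×_)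
open import Relation.Nullary using (Dec)
open import Relation.Nullary.Decidable using (_×-dec_)
open import Data.Rational using (ℚ; 0ℚ; 1ℚ; _+_; _*_; _/_)
import Data.Integer as ℤ
import Data.Fin as F
import Data.List.Relation.Unary.Unique.DecPropositional as UDec

allVec : ∀ k n → List (Vec (Fin n) k)
allVec zero    n = [ [] ]
allVec (suc k) n = concatMap (λ i → map (i ∷_) (allVec k n)) (allFin n)

-- A permutation of [n], represented by its table (π(0),…,π(n-1)) with distinct entries.
IsPerm : ∀ {n} → Vec (Fin n) n → Set
IsPerm π = Unique (toList π)

isPerm? : ∀ {n} (π : Vec (Fin n) n) → Dec (IsPerm π)
isPerm? π = UDec.unique? F._≟_ (toList π)

Event : ∀ {n s} → (Fin s → Fin n) → (Fin s → Subset n) → Vec (Fin n) n → Set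
Event x L π = IsPerm π × (∀ i → lookup π (x i) ∈ L i)

event? : ∀ {n s} (x : Fin s → Fin n) (L : Fin s → Subset n) (π : Vec (Fin n) n) → Dec (Event x L π)
event? x L π = isPerm? π ×-dec all? (λ i → lookup π (x i) ∈? L i)

#perms : ℕ → ℕ
#perms n = length (filter isPerm? (allVec n n))

#event : ∀ {n s} → (Fin s → Fin n) → (Fin s → Subset n) → ℕ
#event {n} x L = length (filter (event? x L) (allVec n n))

-- Reciprocal of a natural number as a rational (with the harmless convention 1/0 = 0;
-- it is only ever applied to n! , to #perms n ≥ 1, and to n when s ≥ 1, so n ≥ 1).
inv : ℕ → ℚ
inv zero    = 0ℚ
inv (suc m) = ℤ.+ 1 / suc m

ℕ→ℚ : ℕ → ℚ
ℕ→ℚ m = ℤ.+ m / 1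

prob : ∀ {n s} → (Fin s → Fin n) → (Fin s → Subset n) → ℚ
prob {n} x L = ℕ→ℚ (#event x L) * inv (#perms n)

∏ : ∀ s → (Fin s → ℚ) → ℚ
∏ zero    f = 1ℚ
∏ (suc s) f = f F.zero * ∏ s (λ i → f (F.suc i))

-- Partial sums  E_N = Σ_{k<N} 1/k!  of the series for Euler's number e;
-- they increase to e.
eApprox : ℕ → ℚ
eApprox zero    = 0ℚ
eApprox (suc N) = eApprox N + inv (N !)

{-# OPTIONS --safe #-}
module Submission where

-- A permutation in the event is determined by the images of the s constrained points, at most
-- ∏ᵢ |Lᵢ| choices, and a bijection from the other n − s points onto the n − s unused values, so
-- the event contains at most ∏ᵢ |Lᵢ| · (n − s)! of the n! permutations. Since (n − j)/n ≥ (s − j)/s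
-- for j < s, we get n^s (n − s)!/n! ≤ s^s/s!, and s^s/s! ≤ E_s^s for the partial sum
-- E_s = Σ_{k<s} 1/k! of e, by induction on s from (1 + t)^t ≤ E_{t+1} t^t, which is the binomial
-- theorem together with C(t, k) k! ≤ t^k.

open import Defs

module FinSums where

  open import Data.Bool.Base using (true; false; if_then_else_)
  open import Data.Nat.Base using (ℕ; zero; suc; _+_; _*_; _≤_; z≤n)
  open import Data.Nat.Properties using (+-mono-≤; +-*-semiring)
  open import Data.Fin.Base using (Fin; zero; suc)
  open import Data.Fin.Subset using (Subset; ∣_∣; inside; outside)
  open import Data.Vec.Base using ([]; _∷_; lookup)
  open import Relation.Binary.PropositionalEquality using (_≡_; refl; sym; cong)
  open import Algebra.Properties.Semiring.Sum +-*-semiring using (sum-syntax; sum-replicate-zero)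

  ∑-mono-≤ : ∀ {n} {f g : Fin n → ℕ} → (∀ i → f i ≤ g i) → ∑[ i < n ] f i ≤ ∑[ i < n ] g i
  ∑-mono-≤ {zero}  f≤g = z≤n
  ∑-mono-≤ {suc n} f≤g = +-mono-≤ (f≤g zero) (∑-mono-≤ (λ i → f≤g (suc i)))

  ∑-if : ∀ {n} b (f : Fin n → ℕ) →
         (if b then ∑[ j < n ] f j else 0) ≡ ∑[ j < n ] (if b then f j else 0)
  ∑-if     true  f = refl
  ∑-if {n} false f = sym (sum-replicate-zero n)

  ∑-indicator : ∀ {n} (S : Subset n) c → ∑[ i < n ] (if lookup S i then c else 0) ≡ ∣ S ∣ * c
  ∑-indicator []            c = refl
  ∑-indicator (inside  ∷ S) c = cong (c +_) (∑-indicator S c)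
  ∑-indicator (outside ∷ S) c = ∑-indicator S c

module ConstrainedInjections where

  open import Data.Bool.Base using (Bool; true; false; T; if_then_else_; _∧_)
  open import Data.Bool.Properties using (T-∧; T-≡; if-swap-then; if-eta; if-cong-then)
  open import Data.Nat.Base using (ℕ; zero; suc; _+_; _*_; _∸_; _≤_; pred; _!; z≤n; +-*-rawSemiring)
  open import Data.Nat.Properties
    using (≤-trans; ≤-reflexive; module ≤-Reasoning; 0∸n≡0; *-assoc; *-identityˡ;
           +-*-semiring; *-commutativeSemigroup)
  open import Data.Nat.Combinatorics.Base using (_P′_)
  open import Data.Nat.Combinatorics.Specification using (nP′k≡n[n∸1P′k∸1]; nP′n≡n!)
  open import Data.Fin.Base using (Fin; zero; suc)
  open import Data.Fin.Properties using (_≟_; suc-injective; 0≢1+n)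
  open import Data.Fin.Subset using (Subset; ∣_∣; inside; outside; _∈_; ⊤)
  open import Data.Fin.Subset.Properties using (∣⊤∣≡n)
  open import Data.Maybe.Base using (Maybe; just; nothing)
  open import Data.Vec.Base using (Vec; []; _∷_; lookup; _[_]≔_; replicate; insertAt; toList)
  open import Data.Vec.Properties
    using (lookup∘update; lookup∘update′; []≔-commutes; lookup-replicate; []=⇒lookup; lookup⇒[]=)
  open import Data.List.Base as List using (List; []; _∷_; length; filter; concat; tabulate)
  open import Data.List.Properties using (filter-++; length-++; map-tabulate; filter-accept; filter-none)
  open import Data.List.Relation.Unary.All as All using (All; []; _∷_)
  open import Data.List.Relation.Unary.AllPairs using ([]; _∷_)
  open import Data.List.Relation.Unary.Unique.Propositional using (Unique)
  open import Data.Product.Base using (_×_; _,_; proj₁; proj₂)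
  open import Data.Empty using (⊥-elim)
  open import Function.Base using (_∘_; id)
  open import Function.Bundles using (_⇔_; mk⇔; Equivalence)
  open import Function.Definitions using (Injective)
  open import Relation.Binary.PropositionalEquality
  open import Relation.Nullary using (yes; no; ¬_; contradiction)
  open import Relation.Unary using (Decidable; _≐_)
  open import Algebra.Properties.Semiring.Sum +-*-semiring using (sum-syntax; ∑-comm; sum-cong-≗)
  open import Algebra.Properties.CommutativeSemigroup *-commutativeSemigroup using (x∙yz≈y∙xz)
  open import Algebra.Definitions.RawSemiring +-*-rawSemiring using (product)
  open FinSums

  suc∣p[i]≔outside∣≡∣p∣ : ∀ {n} (p : Subset n) i → lookup p i ≡ inside →
                          suc ∣ p [ i ]≔ outside ∣ ≡ ∣ p ∣
  suc∣p[i]≔outside∣≡∣p∣ (inside ∷ p) zero    _   = refl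
  suc∣p[i]≔outside∣≡∣p∣ (b      ∷ p) (suc i) i∈p with b
  ... | inside  = cong suc (suc∣p[i]≔outside∣≡∣p∣ p i i∈p)
  ... | outside = suc∣p[i]≔outside∣≡∣p∣ p i i∈p

  Constraint : ℕ → Set
  Constraint n = Maybe (Subset n)

  admits : ∀ {n} → Constraint n → Fin n → Bool
  admits nothing  i = true
  admits (just S) i = lookup S i

  #admissible : ∀ {n k} → Subset n → Vec (Constraint n) k → ℕ
  #admissible     U []      = 1
  #admissible {n} U (c ∷ A) =
    ∑[ i < n ] (if lookup U i ∧ admits c i then #admissible (U [ i ]≔ outside) A else 0)

  #admissible-swap : ∀ {n k} (U : Subset n) a b (A : Vec (Constraint n) k) →
                     #admissible U (a ∷ b ∷ A) ≡ #admissible U (b ∷ a ∷ A)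
  #admissible-swap {n} U a b A = begin
    ∑[ i < n ] (if first a i then ∑[ j < n ] (if second i b j then rest i j else 0) else 0)
      ≡⟨ sum-cong-≗ (λ i → ∑-if {n} (first a i) _) ⟩
    ∑[ i < n ] ∑[ j < n ] (if first a i then (if second i b j then rest i j else 0) else 0)
      ≡⟨ ∑-comm {n} {n} _ ⟩
    ∑[ j < n ] ∑[ i < n ] (if first a i then (if second i b j then rest i j else 0) else 0)
      ≡⟨ sum-cong-≗ (λ j → sum-cong-≗ (λ i → symmetric i j)) ⟩
    ∑[ j < n ] ∑[ i < n ] (if first b j then (if second j a i then rest j i else 0) else 0)
      ≡⟨ sum-cong-≗ (λ j → ∑-if {n} (first b j) _) ⟨
    ∑[ j < n ] (if first b j then ∑[ i < n ] (if second j a i then rest j i else 0) else 0) ∎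
    where
    open ≡-Reasoning
    first : Constraint n → Fin n → Bool
    first c i = lookup U i ∧ admits c i
    second : Fin n → Constraint n → Fin n → Bool
    second i c j = lookup (U [ i ]≔ outside) j ∧ admits c j
    rest : Fin n → Fin n → ℕ
    rest i j = #admissible (U [ i ]≔ outside [ j ]≔ outside) A
    symmetric : ∀ i j → (if first a i then (if second i b j then rest i j else 0) else 0)
                      ≡ (if first b j then (if second j a i then rest j i else 0) else 0)
    symmetric i j with i ≟ j
    ... | yes refl rewrite lookup∘update i U outside = trans (if-eta (first a i)) (sym (if-eta (first b i)))
    ... | no i≢j rewrite lookup∘update′ i≢j U outside | lookup∘update′ (i≢j ∘ sym) U outside =
      trans (if-swap-then (first a i) (first b j))
            (if-cong-then (first b j) (if-cong-then (first a i)
              (cong (λ V → #admissible V A) ([]≔-commutes U i j i≢j))))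

  #admissible-insertAt : ∀ {n k} (U : Subset n) (A : Vec (Constraint n) k) p c →
                         #admissible U (insertAt A p c) ≡ #admissible U (c ∷ A)
  #admissible-insertAt U A       zero    c = refl
  #admissible-insertAt U (a ∷ A) (suc p) c = trans
    (sum-cong-≗ λ i → if-cong-then (lookup U i ∧ admits a i)
                                   (#admissible-insertAt (U [ i ]≔ outside) A p c))
    (#admissible-swap U a c A)

  #constrained : ∀ {n k} → Vec (Constraint n) k → ℕ
  #constrained []            = 0
  #constrained (nothing ∷ A) = #constrained A
  #constrained (just _  ∷ A) = suc (#constrained A)

  ∏sizes : ∀ {n k} → Vec (Constraint n) k → ℕ
  ∏sizes []            = 1
  ∏sizes (nothing ∷ A) = ∏sizes A
  ∏sizes (just S  ∷ A) = ∣ S ∣ * ∏sizes A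

  module _ {n : ℕ} where

    #constrained-replicate : ∀ k → #constrained (replicate {A = Constraint n} k nothing) ≡ 0
    #constrained-replicate zero    = refl
    #constrained-replicate (suc k) = #constrained-replicate k

    ∏sizes-replicate : ∀ k → ∏sizes (replicate {A = Constraint n} k nothing) ≡ 1
    ∏sizes-replicate zero    = refl
    ∏sizes-replicate (suc k) = ∏sizes-replicate k

    #constrained-insertAt : ∀ {k} (A : Vec (Constraint n) k) p S →
                            #constrained (insertAt A p (just S)) ≡ suc (#constrained A)
    #constrained-insertAt A             zero    S = refl
    #constrained-insertAt (nothing ∷ A) (suc p) S = #constrained-insertAt A p S
    #constrained-insertAt (just _  ∷ A) (suc p) S = cong suc (#constrained-insertAt A p S)

    ∏sizes-insertAt : ∀ {k} (A : Vec (Constraint n) k) p S →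
                      ∏sizes (insertAt A p (just S)) ≡ ∣ S ∣ * ∏sizes A
    ∏sizes-insertAt A             zero    S = refl
    ∏sizes-insertAt (nothing ∷ A) (suc p) S = ∏sizes-insertAt A p S
    ∏sizes-insertAt (just T  ∷ A) (suc p) S =
      trans (cong (∣ T ∣ *_) (∏sizes-insertAt A p S)) (x∙yz≈y∙xz ∣ T ∣ ∣ S ∣ (∏sizes A))

    #constrained-update : ∀ {k} (A : Vec (Constraint n) k) p S → lookup A p ≡ nothing →
                          #constrained (A [ p ]≔ just S) ≡ suc (#constrained A)
    #constrained-update (nothing ∷ A) zero    S _  = refl
    #constrained-update (nothing ∷ A) (suc p) S Ap = #constrained-update A p S Ap
    #constrained-update (just _  ∷ A) (suc p) S Ap = cong suc (#constrained-update A p S Ap)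

    ∏sizes-update : ∀ {k} (A : Vec (Constraint n) k) p S → lookup A p ≡ nothing →
                    ∏sizes (A [ p ]≔ just S) ≡ ∣ S ∣ * ∏sizes A
    ∏sizes-update (nothing ∷ A) zero    S _  = refl
    ∏sizes-update (nothing ∷ A) (suc p) S Ap = ∏sizes-update A p S Ap
    ∏sizes-update (just T  ∷ A) (suc p) S Ap =
      trans (cong (∣ T ∣ *_) (∏sizes-update A p S Ap)) (x∙yz≈y∙xz ∣ T ∣ ∣ S ∣ (∏sizes A))

  data Shape {n} : ∀ {k} → Vec (Constraint n) k → Set where
    unconstrained : ∀ k → Shape (replicate k nothing)
    constrainedAt : ∀ {k} (A : Vec (Constraint n) k) p S → Shape (insertAt A p (just S))

  shape : ∀ {n k} (A : Vec (Constraint n) k) → Shape A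
  shape []            = unconstrained 0
  shape (just S  ∷ A) = constrainedAt A zero S
  shape (nothing ∷ A) with shape A
  ... | unconstrained k     = unconstrained (suc k)
  ... | constrainedAt B p S = constrainedAt (nothing ∷ B) (suc p) S

  m*[pred[m]P′k]≡mP′[1+k] : ∀ m k → m * (pred m P′ k) ≡ m P′ suc k
  m*[pred[m]P′k]≡mP′[1+k] zero    k = cong (_* (0 P′ k)) (sym (0∸n≡0 k))
  m*[pred[m]P′k]≡mP′[1+k] (suc m) k = sym (nP′k≡n[n∸1P′k∸1] (suc m) (suc k))

  #admissible-unconstrained : ∀ {n} k (U : Subset n) → #admissible U (replicate k nothing) ≡ ∣ U ∣ P′ k
  #admissible-unconstrained zero    U = refl
  #admissible-unconstrained (suc k) U = begin
    ∑[ i < _ ] (if lookup U i ∧ true then #admissible (U [ i ]≔ outside) (replicate k nothing) else 0)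
      ≡⟨ sum-cong-≗ term ⟩
    ∑[ i < _ ] (if lookup U i then pred ∣ U ∣ P′ k else 0)
      ≡⟨ ∑-indicator U _ ⟩
    ∣ U ∣ * (pred ∣ U ∣ P′ k)
      ≡⟨ m*[pred[m]P′k]≡mP′[1+k] ∣ U ∣ k ⟩
    ∣ U ∣ P′ suc k ∎
    where
    open ≡-Reasoning
    term : ∀ i → (if lookup U i ∧ true then #admissible (U [ i ]≔ outside) (replicate k nothing) else 0)
               ≡ (if lookup U i then pred ∣ U ∣ P′ k else 0)
    term i with lookup U i in i∈U
    ... | true  = trans (#admissible-unconstrained k (U [ i ]≔ outside))
                        (cong (λ m → pred m P′ k) (suc∣p[i]≔outside∣≡∣p∣ U i i∈U))
    ... | false = refl

  -- Pulling a constrained position to the front first is what lets the values taken by the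
  -- constrained positions be discounted from those available to the free ones.
  #admissible-≤ : ∀ {n k} (U : Subset n) (A : Vec (Constraint n) k) →
                  #admissible U A ≤ ∏sizes A * ((∣ U ∣ ∸ #constrained A) P′ (k ∸ #constrained A))
  #admissible-≤ U A with shape A
  ... | unconstrained k = ≤-reflexive (begin
    #admissible U free                        ≡⟨ #admissible-unconstrained k U ⟩
    ∣ U ∣ P′ k                                ≡⟨ *-identityˡ _ ⟨
    bound 1 0                                 ≡⟨ cong₂ bound (∏sizes-replicate k) (#constrained-replicate k) ⟨
    bound (∏sizes free) (#constrained free)   ∎)
    where
    open ≡-Reasoning
    free = replicate k nothing
    bound : ℕ → ℕ → ℕ
    bound a c = a * ((∣ U ∣ ∸ c) P′ (k ∸ c))
  ... | constrainedAt {k} B p S rewrite #constrained-insertAt B p S | ∏sizes-insertAt B p S = begin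
    #admissible U (insertAt B p (just S))
      ≡⟨ #admissible-insertAt U B p (just S) ⟩
    ∑[ i < _ ] (if lookup U i ∧ lookup S i then #admissible (U [ i ]≔ outside) B else 0)
      ≤⟨ ∑-mono-≤ term ⟩
    ∑[ i < _ ] (if lookup S i then bound else 0)
      ≡⟨ ∑-indicator S bound ⟩
    ∣ S ∣ * bound
      ≡⟨ *-assoc ∣ S ∣ (∏sizes B) _ ⟨
    ∣ S ∣ * ∏sizes B * ((∣ U ∣ ∸ suc c) P′ (k ∸ c)) ∎
    where
    open ≤-Reasoning
    c = #constrained B
    bound = ∏sizes B * ((∣ U ∣ ∸ suc c) P′ (k ∸ c))
    term : ∀ i → (if lookup U i ∧ lookup S i then #admissible (U [ i ]≔ outside) B else 0)
               ≤ (if lookup S i then bound else 0)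
    term i with lookup U i in i∈U | lookup S i
    ... | true  | true  = ≤-trans (#admissible-≤ (U [ i ]≔ outside) B)
                            (≤-reflexive (cong (λ m → ∏sizes B * ((m ∸ suc c) P′ (k ∸ c)))
                                               (suc∣p[i]≔outside∣≡∣p∣ U i i∈U)))
    ... | true  | false = z≤n
    ... | false | true  = z≤n
    ... | false | false = z≤n

  Admits : ∀ {n k} → Vec (Constraint n) k → Vec (Fin n) k → Set
  Admits A v = ∀ j → T (admits (lookup A j) (lookup v j))

  Admissible : ∀ {n k} → Subset n → Vec (Constraint n) k → Vec (Fin n) k → Set
  Admissible U A v = Unique (toList v) × All (T ∘ lookup U) (toList v) × Admits A v

  lookup-[]≔outside⇔ : ∀ {n} (U : Subset n) i j →
                  T (lookup (U [ i ]≔ outside) j) ⇔ (i ≢ j × T (lookup U j))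
  lookup-[]≔outside⇔ U i j with i ≟ j
  ... | yes refl = mk⇔ (λ i∈U-i → ⊥-elim (subst T (lookup∘update i U outside) i∈U-i))
                       (λ i≢i×i∈U → contradiction refl (proj₁ i≢i×i∈U))
  ... | no i≢j   = mk⇔ (λ j∈U-i → i≢j , subst T unchanged j∈U-i)
                       (λ (_ , j∈U) → subst T (sym unchanged) j∈U)
    where unchanged = lookup∘update′ (i≢j ∘ sym) U outside

  module _ {n k : ℕ} (U : Subset n) (c : Constraint n)
           {A : Vec (Constraint n) k} {i : Fin n} {v : Vec (Fin n) k} where
    open Equivalence

    admissible-∷⁻ : Admissible U (c ∷ A) (i ∷ v) →
                    T (lookup U i ∧ admits c i) × Admissible (U [ i ]≔ outside) A v
    admissible-∷⁻ (i∉v ∷ unique , i∈U ∷ v⊆U , A∋v) =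
      from T-∧ (i∈U , A∋v zero) ,
      unique , All.zipWith (λ {j} → from (lookup-[]≔outside⇔ U i j)) (i∉v , v⊆U) , A∋v ∘ suc

    admissible-∷⁺ : T (lookup U i ∧ admits c i) → Admissible (U [ i ]≔ outside) A v →
                    Admissible U (c ∷ A) (i ∷ v)
    admissible-∷⁺ ok (unique , v⊆U-i , A∋v) with to T-∧ ok
    ... | i∈U , c∋i =
      All.map (λ {j} → proj₁ ∘ to (lookup-[]≔outside⇔ U i j)) v⊆U-i ∷ unique ,
      i∈U ∷ All.map (λ {j} → proj₂ ∘ to (lookup-[]≔outside⇔ U i j)) v⊆U-i ,
      λ { zero → c∋i ; (suc j) → A∋v j }

  module _ {X : Set} {P : X → Set} (P? : Decidable P) where

    length-filter-concat-tabulate : ∀ {n} (g : Fin n → List X) →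
      length (filter P? (concat (tabulate g))) ≡ ∑[ i < n ] length (filter P? (g i))
    length-filter-concat-tabulate {zero}  g = refl
    length-filter-concat-tabulate {suc n} g = begin
      length (filter P? (g zero List.++ concat (tabulate (g ∘ suc))))
        ≡⟨ cong length (filter-++ P? (g zero) _) ⟩
      length (filter P? (g zero) List.++ filter P? (concat (tabulate (g ∘ suc))))
        ≡⟨ length-++ (filter P? (g zero)) ⟩
      length (filter P? (g zero)) + length (filter P? (concat (tabulate (g ∘ suc))))
        ≡⟨ cong (length (filter P? (g zero)) +_) (length-filter-concat-tabulate (g ∘ suc)) ⟩
      ∑[ i < suc n ] length (filter P? (g i)) ∎
      where open ≡-Reasoning

    length-filter-map : ∀ {Y : Set} (f : Y → X) xs →
                        length (filter P? (List.map f xs)) ≡ length (filter (P? ∘ f) xs)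
    length-filter-map f []       = refl
    length-filter-map f (x ∷ xs) with P? (f x)
    ... | yes _ = cong suc (length-filter-map f xs)
    ... | no  _ = length-filter-map f xs

    length-filter-∅ : (∀ x → ¬ P x) → ∀ xs → length (filter P? xs) ≡ 0
    length-filter-∅ ∅ xs = cong length (filter-none P? (All.universal ∅ xs))

  #admissible-enumerates : ∀ {n k} {P : Vec (Fin n) k → Set} (P? : Decidable P) U A →
                           P ≐ Admissible U A → length (filter P? (allVec k n)) ≡ #admissible U A
  #admissible-enumerates P? U [] (_ , adm⊆P) = cong length (filter-accept P? (adm⊆P ([] , [] , λ ())))
  #admissible-enumerates {n} {suc k} P? U (c ∷ A) (P⊆adm , adm⊆P) = begin
    length (filter P? (concat (List.map extend (tabulate id))))
      ≡⟨ cong (length ∘ filter P? ∘ concat) (map-tabulate id extend) ⟩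
    length (filter P? (concat (tabulate extend)))
      ≡⟨ length-filter-concat-tabulate P? extend ⟩
    ∑[ i < n ] length (filter P? (List.map (i ∷_) (allVec k n)))
      ≡⟨ sum-cong-≗ (λ i → length-filter-map P? (i ∷_) (allVec k n)) ⟩
    ∑[ i < n ] length (filter (P? ∘ (i ∷_)) (allVec k n))
      ≡⟨ sum-cong-≗ branch ⟩
    #admissible U (c ∷ A) ∎
    where
    open ≡-Reasoning
    extend : Fin n → List (Vec (Fin n) (suc k))
    extend i = List.map (i ∷_) (allVec k n)
    branch : ∀ i → length (filter (P? ∘ (i ∷_)) (allVec k n))
                 ≡ (if lookup U i ∧ admits c i then #admissible (U [ i ]≔ outside) A else 0)
    branch i with lookup U i ∧ admits c i in ok
    ... | true  = #admissible-enumerates (P? ∘ (i ∷_)) (U [ i ]≔ outside) A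
                    ( (λ p → proj₂ (admissible-∷⁻ U c (P⊆adm p)))
                    , (λ adm → adm⊆P (admissible-∷⁺ U c (subst T (sym ok) _) adm)))
    ... | false = length-filter-∅ (P? ∘ (i ∷_))
                    (λ v p → subst T ok (proj₁ (admissible-∷⁻ U c (P⊆adm p)))) (allVec k n)

  constraints : ∀ {n s} → (Fin s → Fin n) → (Fin s → Subset n) → Vec (Constraint n) n
  constraints {n} {zero}  x L = replicate n nothing
  constraints {s = suc s} x L = constraints (x ∘ suc) (L ∘ suc) [ x zero ]≔ just (L zero)

  module _ {n : ℕ} where

    admits-unconstrained : ∀ {k} (v : Vec (Fin n) k) → Admits (replicate k nothing) v
    admits-unconstrained v j = subst (λ c → T (admits c (lookup v j))) (sym (lookup-replicate j nothing)) _

    lookup-constraints-∉ : ∀ {s} (x : Fin s → Fin n) L p → (∀ i → x i ≢ p) →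
                           lookup (constraints x L) p ≡ nothing
    lookup-constraints-∉ {zero}  x L p _   = lookup-replicate p nothing
    lookup-constraints-∉ {suc s} x L p p∉x =
      trans (lookup∘update′ (p∉x zero ∘ sym) (constraints (x ∘ suc) (L ∘ suc)) _)
            (lookup-constraints-∉ (x ∘ suc) (L ∘ suc) p (p∉x ∘ suc))

    lookup-constraints : ∀ {s} (x : Fin s → Fin n) L → Injective _≡_ _≡_ x →
                         ∀ i → lookup (constraints x L) (x i) ≡ just (L i)
    lookup-constraints {suc s} x L x-inj zero    = lookup∘update (x zero) (constraints (x ∘ suc) (L ∘ suc)) _
    lookup-constraints {suc s} x L x-inj (suc i) =
      trans (lookup∘update′ (0≢1+n ∘ x-inj ∘ sym) (constraints (x ∘ suc) (L ∘ suc)) _)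
            (lookup-constraints (x ∘ suc) (L ∘ suc) (suc-injective ∘ x-inj) i)

    admits-constraints : ∀ {s} (x : Fin s → Fin n) L (π : Vec (Fin n) n) →
                         (∀ i → T (lookup (L i) (lookup π (x i)))) → Admits (constraints x L) π
    admits-constraints {zero}  x L π _ = admits-unconstrained π
    admits-constraints {suc s} x L π π∈L j with x zero ≟ j
    ... | yes refl = subst (λ c → T (admits c (lookup π (x zero))))
                           (sym (lookup∘update (x zero) (constraints (x ∘ suc) (L ∘ suc)) _)) (π∈L zero)
    ... | no x₀≢j  = subst (λ c → T (admits c (lookup π j)))
                           (sym (lookup∘update′ (x₀≢j ∘ sym) (constraints (x ∘ suc) (L ∘ suc)) _))
                           (admits-constraints (x ∘ suc) (L ∘ suc) π (π∈L ∘ suc) j)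

    #constrained∧∏sizes-constraints : ∀ {s} (x : Fin s → Fin n) L → Injective _≡_ _≡_ x →
      #constrained (constraints x L) ≡ s × ∏sizes (constraints x L) ≡ product (λ i → ∣ L i ∣)
    #constrained∧∏sizes-constraints {zero}  x L _     = #constrained-replicate n , ∏sizes-replicate n
    #constrained∧∏sizes-constraints {suc s} x L x-inj =
      trans (#constrained-update C (x zero) (L zero) x₀-free) (cong suc (proj₁ ih)) ,
      trans (∏sizes-update C (x zero) (L zero) x₀-free) (cong (∣ L zero ∣ *_) (proj₂ ih))
      where
      C = constraints (x ∘ suc) (L ∘ suc)
      ih = #constrained∧∏sizes-constraints (x ∘ suc) (L ∘ suc) (suc-injective ∘ x-inj)
      x₀-free : lookup C (x zero) ≡ nothing
      x₀-free = lookup-constraints-∉ (x ∘ suc) (L ∘ suc) (x zero) (λ i → 0≢1+n ∘ x-inj ∘ sym)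

  ∈⇔T-lookup : ∀ {n} {i : Fin n} {S} → i ∈ S ⇔ T (lookup S i)
  ∈⇔T-lookup {i = i} {S} =
    mk⇔ (λ i∈S → subst T (sym ([]=⇒lookup i∈S)) _) (lookup⇒[]= i S ∘ Equivalence.to T-≡)

  T-lookup-⊤ : ∀ {n} (i : Fin n) → T (lookup ⊤ i)
  T-lookup-⊤ i = subst T (sym (lookup-replicate i inside)) _

  #perms≡n! : ∀ n → #perms n ≡ n !
  #perms≡n! n = begin
    #perms n                          ≡⟨ #admissible-enumerates isPerm? ⊤ free (perm⇒admissible , proj₁) ⟩
    #admissible ⊤ free                ≡⟨ #admissible-unconstrained n ⊤ ⟩
    ∣ ⊤ {n} ∣ P′ n                    ≡⟨ cong (_P′ n) (∣⊤∣≡n n) ⟩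
    n P′ n                            ≡⟨ nP′n≡n! n ⟩
    n !                               ∎
    where
    open ≡-Reasoning
    free = replicate n nothing
    perm⇒admissible : ∀ {π} → IsPerm π → Admissible ⊤ free π
    perm⇒admissible {π} unique = unique , All.universal T-lookup-⊤ _ , admits-unconstrained π

  #event-≤ : ∀ {n s} (x : Fin s → Fin n) L → Injective _≡_ _≡_ x →
             #event x L ≤ product (λ i → ∣ L i ∣) * (n ∸ s) !
  #event-≤ {n} {s} x L x-inj = begin
    #event x L
      ≡⟨ #admissible-enumerates (event? x L) ⊤ C (event⇒admissible , admissible⇒event) ⟩
    #admissible ⊤ C
      ≤⟨ #admissible-≤ ⊤ C ⟩
    ∏sizes C * ((∣ ⊤ {n} ∣ ∸ #constrained C) P′ (n ∸ #constrained C))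
      ≡⟨ cong₂ (λ p c → p * ((∣ ⊤ {n} ∣ ∸ c) P′ (n ∸ c))) (proj₂ C-sizes) (proj₁ C-sizes) ⟩
    product (λ i → ∣ L i ∣) * ((∣ ⊤ {n} ∣ ∸ s) P′ (n ∸ s))
      ≡⟨ cong (λ m → product (λ i → ∣ L i ∣) * ((m ∸ s) P′ (n ∸ s))) (∣⊤∣≡n n) ⟩
    product (λ i → ∣ L i ∣) * ((n ∸ s) P′ (n ∸ s))
      ≡⟨ cong (product (λ i → ∣ L i ∣) *_) (nP′n≡n! (n ∸ s)) ⟩
    product (λ i → ∣ L i ∣) * (n ∸ s) ! ∎
    where
    open ≤-Reasoning
    C = constraints x L
    C-sizes = #constrained∧∏sizes-constraints x L x-inj
    event⇒admissible : ∀ {π} → Event x L π → Admissible ⊤ C π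
    event⇒admissible {π} (unique , π∈L) =
      unique , All.universal T-lookup-⊤ _ ,
      admits-constraints x L π (λ i → Equivalence.to ∈⇔T-lookup (π∈L i))
    admissible⇒event : ∀ {π} → Admissible ⊤ C π → Event x L π
    admissible⇒event {π} (unique , _ , C∋π) = unique , λ i → Equivalence.from ∈⇔T-lookup
      (subst (λ c → T (admits c (lookup π (x i)))) (lookup-constraints x L x-inj i) (C∋π (x i)))

module FallingFactorials where

  open import Data.Bool.Base using (true)
  open import Data.Nat.Base using (ℕ; zero; suc; _+_; _*_; _∸_; _^_; _≤_; _≤ᵇ_; _!)
  open import Data.Nat.Properties
  open import Data.Nat.Divisibility using (_∣_; m≤n⇒m!∣n!)
  open import Data.Nat.DivMod using (_/_; m/n*n≡m)
  open import Data.Nat.Combinatorics using (_C_; _P_; nCk≡nPk/k!)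
  open import Data.Nat.Combinatorics.Base using (_P′_)
  open import Data.Nat.Combinatorics.Specification
    using (nP′k≡n!/[n∸k]!; k!∣nP′k; nP′n≡n!; nP′k≡n[n∸1P′k∸1])
  open import Data.Nat.Tactic.RingSolver using (solve-∀)
  open import Data.Fin.Base using (toℕ)
  open import Data.Fin.Properties using (toℕ≤pred[n])
  open import Relation.Binary.PropositionalEquality
  open import Algebra.Properties.Semiring.Sum +-*-semiring
    using (sum-syntax; sum⁺-syntax; sum-cong-≗; *-distribˡ-sum; *-distribʳ-sum)
  import Algebra.Properties.Semiring.Mult +-*-semiring as Mult
  import Algebra.Properties.Semiring.Exp +-*-semiring as Exp
  import Algebra.Properties.CommutativeSemiring.Binomial +-*-commutativeSemiring as Binomial
  open FinSums using (∑-mono-≤)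

  nP′k*[n∸k]!≡n! : ∀ {n k} → k ≤ n → (n P′ k) * (n ∸ k) ! ≡ n !
  nP′k*[n∸k]!≡n! {n} {k} k≤n =
    trans (cong (_* (n ∸ k) !) (nP′k≡n!/[n∸k]! k≤n)) (m/n*n≡m (m≤n⇒m!∣n! (m∸n≤m n k)))
    where instance _ = (n ∸ k) !≢0

  nPk≡nP′k : ∀ {n k} → k ≤ n → n P k ≡ n P′ k
  nPk≡nP′k {n} {k} k≤n with k ≤ᵇ n | ≤⇒≤ᵇ k≤n
  ... | true | _ = refl

  nCk*k!≡nP′k : ∀ {n k} → k ≤ n → (n C k) * k ! ≡ n P′ k
  nCk*k!≡nP′k {n} {k} k≤n = begin
    (n C k) * k !           ≡⟨ cong (_* k !) (nCk≡nPk/k! k≤n) ⟩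
    ((n P k) / k !) * k !   ≡⟨ m/n*n≡m (subst (k ! ∣_) (sym (nPk≡nP′k k≤n)) (k!∣nP′k k≤n)) ⟩
    n P k                   ≡⟨ nPk≡nP′k k≤n ⟩
    n P′ k                  ∎
    where open ≡-Reasoning; instance _ = k !≢0

  nP′k≤n^k : ∀ n k → n P′ k ≤ n ^ k
  nP′k≤n^k n zero    = ≤-refl
  nP′k≤n^k n (suc k) = *-mono-≤ (m∸n≤m n k) (nP′k≤n^k n k)

  n!≤n^[n∸k]*k! : ∀ {n k} → k ≤ n → n ! ≤ n ^ (n ∸ k) * k !
  n!≤n^[n∸k]*k! {n} {k} k≤n = begin
    n !                                 ≡⟨ nP′k*[n∸k]!≡n! (m∸n≤m n k) ⟨
    (n P′ (n ∸ k)) * (n ∸ (n ∸ k)) !    ≡⟨ cong (λ m → (n P′ (n ∸ k)) * m !) (m∸[m∸n]≡n k≤n) ⟩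
    (n P′ (n ∸ k)) * k !                ≤⟨ *-monoˡ-≤ (k !) (nP′k≤n^k n (n ∸ k)) ⟩
    n ^ (n ∸ k) * k !                   ∎
    where open ≤-Reasoning

  n*[s∸t]≤s*[n∸t] : ∀ {s n} t → s ≤ n → n * (s ∸ t) ≤ s * (n ∸ t)
  n*[s∸t]≤s*[n∸t] {s} {n} t s≤n = begin
    n * (s ∸ t)     ≡⟨ *-distribˡ-∸ n s t ⟩
    n * s ∸ n * t   ≤⟨ ∸-mono (≤-reflexive (*-comm n s)) (*-monoˡ-≤ t s≤n) ⟩
    s * n ∸ s * t   ≡⟨ *-distribˡ-∸ s n t ⟨
    s * (n ∸ t)     ∎
    where open ≤-Reasoning

  n^t*sP′t≤s^t*nP′t : ∀ {s n} t → s ≤ n → n ^ t * (s P′ t) ≤ s ^ t * (n P′ t)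
  n^t*sP′t≤s^t*nP′t         zero    s≤n = ≤-refl
  n^t*sP′t≤s^t*nP′t {s} {n} (suc t) s≤n = begin
    (n * n ^ t) * ((s ∸ t) * (s P′ t))   ≡⟨ interchange n (n ^ t) (s ∸ t) (s P′ t) ⟩
    (n * (s ∸ t)) * (n ^ t * (s P′ t))   ≤⟨ *-mono-≤ (n*[s∸t]≤s*[n∸t] t s≤n) (n^t*sP′t≤s^t*nP′t t s≤n) ⟩
    (s * (n ∸ t)) * (s ^ t * (n P′ t))   ≡⟨ interchange s (n ∸ t) (s ^ t) (n P′ t) ⟩
    (s * s ^ t) * ((n ∸ t) * (n P′ t))   ∎
    where
    open ≤-Reasoning
    interchange : ∀ a b c d → (a * b) * (c * d) ≡ (a * c) * (b * d)
    interchange = solve-∀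

  [n∸s]!*n^s*s!≤s^s*n! : ∀ {s n} → s ≤ n → (n ∸ s) ! * n ^ s * s ! ≤ s ^ s * n !
  [n∸s]!*n^s*s!≤s^s*n! {s} {n} s≤n = begin
    (n ∸ s) ! * n ^ s * s !          ≡⟨ cong ((n ∸ s) ! * n ^ s *_) (nP′n≡n! s) ⟨
    (n ∸ s) ! * n ^ s * (s P′ s)     ≡⟨ rotate ((n ∸ s) !) (n ^ s) (s P′ s) ⟩
    n ^ s * (s P′ s) * (n ∸ s) !     ≤⟨ *-monoˡ-≤ ((n ∸ s) !) (n^t*sP′t≤s^t*nP′t s s≤n) ⟩
    s ^ s * (n P′ s) * (n ∸ s) !     ≡⟨ *-assoc (s ^ s) (n P′ s) ((n ∸ s) !) ⟩
    s ^ s * ((n P′ s) * (n ∸ s) !)   ≡⟨ cong (s ^ s *_) (nP′k*[n∸k]!≡n! s≤n) ⟩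
    s ^ s * n !                      ∎
    where
    open ≤-Reasoning
    rotate : ∀ a b c → a * b * c ≡ b * c * a
    rotate = solve-∀

  ×≡* : ∀ m x → m Mult.× x ≡ m * x
  ×≡* zero    x = refl
  ×≡* (suc m) x = cong (x +_) (×≡* m x)

  ^≡^ : ∀ x m → x Exp.^ m ≡ x ^ m
  ^≡^ x zero    = refl
  ^≡^ x (suc m) = cong (x *_) (^≡^ x m)

  binomial : ∀ x y n → (x + y) ^ n ≡ ∑[ k ≤ n ] ((n C toℕ k) * (x ^ toℕ k * y ^ (n ∸ toℕ k)))
  binomial x y n = begin
    (x + y) ^ n                        ≡⟨ ^≡^ (x + y) n ⟨
    (x + y) Exp.^ n                    ≡⟨ Binomial.theorem n x y ⟩
    Binomial.binomialExpansion x y n   ≡⟨ sum-cong-≗ {suc n} term ⟩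
    ∑[ k ≤ n ] ((n C toℕ k) * (x ^ toℕ k * y ^ (n ∸ toℕ k))) ∎
    where
    open ≡-Reasoning
    term : ∀ k → Binomial.binomialTerm x y n k ≡ (n C toℕ k) * (x ^ toℕ k * y ^ (n ∸ toℕ k))
    term k = trans (×≡* (n C toℕ k) _)
                   (cong ((n C toℕ k) *_) (cong₂ _*_ (^≡^ x (toℕ k)) (^≡^ y (n ∸ toℕ k))))

  arrangements : ℕ → ℕ
  arrangements t = ∑[ k ≤ t ] (t P′ toℕ k)

  arrangements-suc : ∀ t → arrangements (suc t) ≡ 1 + suc t * arrangements t
  arrangements-suc t = cong (1 +_) (begin
    ∑[ k ≤ t ] (suc t P′ suc (toℕ k))
      ≡⟨ sum-cong-≗ {suc t} (λ k → nP′k≡n[n∸1P′k∸1] (suc t) (suc (toℕ k))) ⟩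
    ∑[ k ≤ t ] (suc t * (t P′ toℕ k))
      ≡⟨ *-distribˡ-sum {suc t} (suc t) (λ k → t P′ toℕ k) ⟨
    suc t * arrangements t ∎)
    where open ≡-Reasoning

  [1+t]^t*t!≤t^t*arrangements : ∀ t → (1 + t) ^ t * t ! ≤ t ^ t * arrangements t
  [1+t]^t*t!≤t^t*arrangements t = begin
    (1 + t) ^ t * t !
      ≡⟨ cong (λ m → m ^ t * t !) (+-comm 1 t) ⟩
    (t + 1) ^ t * t !
      ≡⟨ cong (_* t !) (binomial t 1 t) ⟩
    (∑[ k ≤ t ] ((t C toℕ k) * (t ^ toℕ k * 1 ^ (t ∸ toℕ k)))) * t !
      ≡⟨ *-distribʳ-sum {suc t} (t !) (λ k → (t C toℕ k) * (t ^ toℕ k * 1 ^ (t ∸ toℕ k))) ⟩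
    ∑[ k ≤ t ] ((t C toℕ k) * (t ^ toℕ k * 1 ^ (t ∸ toℕ k)) * t !)
      ≤⟨ ∑-mono-≤ (λ k → term (toℕ k) (toℕ≤pred[n] k)) ⟩
    ∑[ k ≤ t ] (t ^ t * (t P′ toℕ k))
      ≡⟨ *-distribˡ-sum {suc t} (t ^ t) (λ k → t P′ toℕ k) ⟨
    t ^ t * arrangements t ∎
    where
    open ≤-Reasoning
    term : ∀ k → k ≤ t → (t C k) * (t ^ k * 1 ^ (t ∸ k)) * t ! ≤ t ^ t * (t P′ k)
    term k k≤t = begin
      (t C k) * (t ^ k * 1 ^ (t ∸ k)) * t !
        ≡⟨ cong (λ m → (t C k) * (t ^ k * m) * t !) (^-zeroˡ (t ∸ k)) ⟩
      (t C k) * (t ^ k * 1) * t !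
        ≤⟨ *-monoʳ-≤ ((t C k) * (t ^ k * 1)) (n!≤n^[n∸k]*k! k≤t) ⟩
      (t C k) * (t ^ k * 1) * (t ^ (t ∸ k) * k !)
        ≡⟨ rearrange (t C k) (t ^ k) (t ^ (t ∸ k)) (k !) ⟩
      (t ^ k * t ^ (t ∸ k)) * ((t C k) * k !)
        ≡⟨ cong₂ _*_ (trans (sym (^-distribˡ-+-* t k (t ∸ k))) (cong (t ^_) (m+[n∸m]≡n k≤t)))
                     (nCk*k!≡nP′k k≤t) ⟩
      t ^ t * (t P′ k) ∎
      where
      rearrange : ∀ c a b f → c * (a * 1) * (b * f) ≡ (a * b) * (c * f)
      rearrange = solve-∀

module RationalBounds where

  open import Data.Nat.Base as ℕ using (ℕ; zero; suc; _!; _^_; z≤n; s≤s; _≤′_; ≤′-refl; ≤′-step)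
  import Data.Nat.Properties as ℕₚ
  open import Data.Nat.Coprimality as Coprime using (1-coprimeTo)
  import Data.Integer.Base as ℤ
  import Data.Integer.Properties as ℤₚ
  open import Data.Fin.Base as Fin using (Fin)
  open import Data.Fin.Subset using (Subset; ∣_∣)
  open import Data.Rational.Base hiding (∣_∣)
  open import Data.Rational.Properties
  open import Data.Rational.Solver using (module +-*-Solver)
  open import Function.Base using (_∘_)
  open import Function.Definitions using (Injective)
  open import Relation.Binary.PropositionalEquality
  open import Algebra.Definitions.RawSemiring ℕ.+-*-rawSemiring using (product)
  open +-*-Solver
  open ConstrainedInjections using (#perms≡n!; #event-≤)
  open FallingFactorials
    using (arrangements; arrangements-suc; [1+t]^t*t!≤t^t*arrangements; [n∸s]!*n^s*s!≤s^s*n!)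
  open ℕₚ using (_!≢0)

  ℕ→ℚ≡mkℚ : ∀ m → ℕ→ℚ m ≡ mkℚ (ℤ.+ m) 0 (Coprime.sym (1-coprimeTo m))
  ℕ→ℚ≡mkℚ m = normalize-coprime (Coprime.sym (1-coprimeTo m))

  ℕ→ℚ-+ : ∀ a b → ℕ→ℚ (a ℕ.+ b) ≡ ℕ→ℚ a + ℕ→ℚ b
  ℕ→ℚ-+ a b rewrite ℕ→ℚ≡mkℚ a | ℕ→ℚ≡mkℚ b = cong (_/ 1) (trans (ℤₚ.pos-+ a b)
    (sym (cong₂ ℤ._+_ (ℤₚ.*-identityʳ (ℤ.+ a)) (ℤₚ.*-identityʳ (ℤ.+ b)))))

  ℕ→ℚ-* : ∀ a b → ℕ→ℚ (a ℕ.* b) ≡ ℕ→ℚ a * ℕ→ℚ b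
  ℕ→ℚ-* a b rewrite ℕ→ℚ≡mkℚ a | ℕ→ℚ≡mkℚ b = cong (_/ 1) (ℤₚ.pos-* a b)

  ℕ→ℚ-mono-≤ : ∀ {a b} → a ℕ.≤ b → ℕ→ℚ a ≤ ℕ→ℚ b
  ℕ→ℚ-mono-≤ {a} {b} a≤b rewrite ℕ→ℚ≡mkℚ a | ℕ→ℚ≡mkℚ b =
    *≤* (subst₂ ℤ._≤_ (sym (ℤₚ.*-identityʳ (ℤ.+ a))) (sym (ℤₚ.*-identityʳ (ℤ.+ b))) (ℤ.+≤+ a≤b))

  ℕ→ℚ-nonNeg : ∀ m → NonNegative (ℕ→ℚ m)
  ℕ→ℚ-nonNeg m = normalize-nonNeg m 1

  ℕ→ℚ-pos : ∀ m .{{_ : ℕ.NonZero m}} → Positive (ℕ→ℚ m)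
  ℕ→ℚ-pos m = normalize-pos m 1

  inv-nonNeg : ∀ m → NonNegative (inv m)
  inv-nonNeg zero    = _
  inv-nonNeg (suc m) = normalize-nonNeg 1 (suc m)

  inv-cancel : ∀ m .{{_ : ℕ.NonZero m}} → inv m * ℕ→ℚ m ≡ 1ℚ
  inv-cancel (suc m) rewrite normalize-coprime (1-coprimeTo (suc m)) | ℕ→ℚ≡mkℚ (suc m) =
    *-inverseˡ (mkℚ (ℤ.+ suc m) 0 (Coprime.sym (1-coprimeTo (suc m))))

  p≤p+q : ∀ {p q} → 0ℚ ≤ q → p ≤ p + q
  p≤p+q {p} 0≤q = subst (_≤ p + _) (+-identityʳ p) (+-monoʳ-≤ p 0≤q)

  interchange : ∀ a b c d → (a * b) * (c * d) ≡ (a * c) * (b * d)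
  interchange = solve 4 (λ a b c d → (a :* b) :* (c :* d) := (a :* c) :* (b :* d)) refl

  ∏-* : ∀ s (f g : Fin s → ℚ) → ∏ s (λ i → f i * g i) ≡ ∏ s f * ∏ s g
  ∏-* zero    f g = refl
  ∏-* (suc s) f g = trans (cong (f Fin.zero * g Fin.zero *_) (∏-* s (f ∘ Fin.suc) (g ∘ Fin.suc)))
                          (interchange (f Fin.zero) (g Fin.zero) (∏ s (f ∘ Fin.suc)) (∏ s (g ∘ Fin.suc)))

  ℕ→ℚ-product : ∀ s (h : Fin s → ℕ) → ∏ s (ℕ→ℚ ∘ h) ≡ ℕ→ℚ (product h)
  ℕ→ℚ-product zero    h = refl
  ℕ→ℚ-product (suc s) h = trans (cong (ℕ→ℚ (h Fin.zero) *_) (ℕ→ℚ-product s (h ∘ Fin.suc)))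
                                (sym (ℕ→ℚ-* (h Fin.zero) (product (h ∘ Fin.suc))))

  ∏-inv*ℕ→ℚ[n^s]≡1 : ∀ {s n} → s ℕ.≤ n → ∏ s (λ _ → inv n) * ℕ→ℚ (n ^ s) ≡ 1ℚ
  ∏-inv*ℕ→ℚ[n^s]≡1 {zero}          _         = refl
  ∏-inv*ℕ→ℚ[n^s]≡1 {suc s} {suc m} (s≤s s≤m) = begin
    (inv n * invˢ) * ℕ→ℚ (n ℕ.* n ^ s)
      ≡⟨ cong (inv n * invˢ *_) (ℕ→ℚ-* n (n ^ s)) ⟩
    (inv n * invˢ) * (ℕ→ℚ n * ℕ→ℚ (n ^ s))
      ≡⟨ interchange (inv n) invˢ (ℕ→ℚ n) (ℕ→ℚ (n ^ s)) ⟩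
    (inv n * ℕ→ℚ n) * (invˢ * ℕ→ℚ (n ^ s))
      ≡⟨ cong₂ _*_ (inv-cancel n) (∏-inv*ℕ→ℚ[n^s]≡1 (ℕₚ.m≤n⇒m≤1+n s≤m)) ⟩
    1ℚ * 1ℚ
      ≡⟨⟩
    1ℚ ∎
    where
    open ≡-Reasoning
    n = suc m
    invˢ = ∏ s (λ _ → inv n)

  ∏[E*f*inv[n]]*ℕ→ℚ[n^s] : ∀ E {s n} (f : Fin s → ℕ) → s ℕ.≤ n →
    ∏ s (λ i → E * ℕ→ℚ (f i) * inv n) * ℕ→ℚ (n ^ s) ≡ ∏ s (λ _ → E) * ℕ→ℚ (product f)
  ∏[E*f*inv[n]]*ℕ→ℚ[n^s] E {s} {n} f s≤n = begin
    ∏ s (λ i → E * ℕ→ℚ (f i) * inv n) * ℕ→ℚ (n ^ s)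
      ≡⟨ cong (_* ℕ→ℚ (n ^ s)) (∏-* s (λ i → E * ℕ→ℚ (f i)) (λ _ → inv n)) ⟩
    ∏ s (λ i → E * ℕ→ℚ (f i)) * ∏ s (λ _ → inv n) * ℕ→ℚ (n ^ s)
      ≡⟨ *-assoc (∏ s (λ i → E * ℕ→ℚ (f i))) _ _ ⟩
    ∏ s (λ i → E * ℕ→ℚ (f i)) * (∏ s (λ _ → inv n) * ℕ→ℚ (n ^ s))
      ≡⟨ cong₂ _*_ (trans (∏-* s (λ _ → E) (ℕ→ℚ ∘ f)) (cong (∏ s (λ _ → E) *_) (ℕ→ℚ-product s f)))
                   (∏-inv*ℕ→ℚ[n^s]≡1 s≤n) ⟩
    ∏ s (λ _ → E) * ℕ→ℚ (product f) * 1ℚ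
      ≡⟨ *-identityʳ _ ⟩
    ∏ s (λ _ → E) * ℕ→ℚ (product f) ∎
    where open ≡-Reasoning

  eApprox[1+t]*t!≡arrangements : ∀ t → eApprox (suc t) * ℕ→ℚ (t !) ≡ ℕ→ℚ (arrangements t)
  eApprox[1+t]*t!≡arrangements zero    = refl
  eApprox[1+t]*t!≡arrangements (suc t) = begin
    (e + inv (suc t !)) * ℕ→ℚ (suc t ℕ.* t !)
      ≡⟨ cong ((e + inv (suc t !)) *_) (ℕ→ℚ-* (suc t) (t !)) ⟩
    (e + inv (suc t !)) * (ℕ→ℚ (suc t) * ℕ→ℚ (t !))
      ≡⟨ distribute e (inv (suc t !)) (ℕ→ℚ (suc t)) (ℕ→ℚ (t !)) ⟩
    ℕ→ℚ (suc t) * (e * ℕ→ℚ (t !)) + inv (suc t !) * (ℕ→ℚ (suc t) * ℕ→ℚ (t !))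
      ≡⟨ cong₂ (λ a b → ℕ→ℚ (suc t) * a + inv (suc t !) * b)
               (eApprox[1+t]*t!≡arrangements t) (sym (ℕ→ℚ-* (suc t) (t !))) ⟩
    ℕ→ℚ (suc t) * ℕ→ℚ (arrangements t) + inv (suc t !) * ℕ→ℚ (suc t !)
      ≡⟨ cong₂ _+_ (ℕ→ℚ-* (suc t) (arrangements t)) (sym (inv-cancel (suc t !) {{suc t !≢0}})) ⟨
    ℕ→ℚ (suc t ℕ.* arrangements t) + 1ℚ
      ≡⟨ +-comm (ℕ→ℚ (suc t ℕ.* arrangements t)) 1ℚ ⟩
    ℕ→ℚ 1 + ℕ→ℚ (suc t ℕ.* arrangements t)
      ≡⟨ ℕ→ℚ-+ 1 (suc t ℕ.* arrangements t) ⟨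
    ℕ→ℚ (1 ℕ.+ suc t ℕ.* arrangements t)
      ≡⟨ cong ℕ→ℚ (arrangements-suc t) ⟨
    ℕ→ℚ (arrangements (suc t)) ∎
    where
    open ≡-Reasoning
    e = eApprox (suc t)
    distribute : ∀ e i a b → (e + i) * (a * b) ≡ a * (e * b) + i * (a * b)
    distribute = solve 4 (λ e i a b → (e :+ i) :* (a :* b) := a :* (e :* b) :+ i :* (a :* b)) refl

  eApprox-mono-≤′ : ∀ {m n} → m ≤′ n → eApprox m ≤ eApprox n
  eApprox-mono-≤′ ≤′-refl             = ≤-refl
  eApprox-mono-≤′ (≤′-step {n} m≤′n) =
    ≤-trans (eApprox-mono-≤′ m≤′n) (p≤p+q (nonNegative⁻¹ (inv (n !)) {{inv-nonNeg (n !)}}))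

  eApprox-nonNeg : ∀ n → NonNegative (eApprox n)
  eApprox-nonNeg n = nonNegative (eApprox-mono-≤′ (ℕₚ.≤⇒≤′ (z≤n {n})))

  [1+t]^t≤eApprox[1+t]*t^t : ∀ t → ℕ→ℚ ((1 ℕ.+ t) ^ t) ≤ eApprox (suc t) * ℕ→ℚ (t ^ t)
  [1+t]^t≤eApprox[1+t]*t^t t = *-cancelʳ-≤-pos (ℕ→ℚ (t !)) {{ℕ→ℚ-pos (t !) {{t !≢0}}}} (begin
    ℕ→ℚ ((1 ℕ.+ t) ^ t) * ℕ→ℚ (t !)
      ≡⟨ ℕ→ℚ-* ((1 ℕ.+ t) ^ t) (t !) ⟨
    ℕ→ℚ ((1 ℕ.+ t) ^ t ℕ.* t !)
      ≤⟨ ℕ→ℚ-mono-≤ ([1+t]^t*t!≤t^t*arrangements t) ⟩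
    ℕ→ℚ (t ^ t ℕ.* arrangements t)
      ≡⟨ ℕ→ℚ-* (t ^ t) (arrangements t) ⟩
    ℕ→ℚ (t ^ t) * ℕ→ℚ (arrangements t)
      ≡⟨ cong (ℕ→ℚ (t ^ t) *_) (eApprox[1+t]*t!≡arrangements t) ⟨
    ℕ→ℚ (t ^ t) * (eApprox (suc t) * ℕ→ℚ (t !))
      ≡⟨ rearrange (ℕ→ℚ (t ^ t)) (eApprox (suc t)) (ℕ→ℚ (t !)) ⟩
    eApprox (suc t) * ℕ→ℚ (t ^ t) * ℕ→ℚ (t !) ∎)
    where
    open ≤-Reasoning
    rearrange : ∀ a e f → a * (e * f) ≡ e * a * f
    rearrange = solve 3 (λ a e f → a :* (e :* f) := e :* a :* f) refl

  t^t≤E^t*t! : ∀ E .{{_ : NonNegative E}} t →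
               (∀ {j} → j ℕ.< t → ℕ→ℚ ((1 ℕ.+ j) ^ j) ≤ E * ℕ→ℚ (j ^ j)) →
               ℕ→ℚ (t ^ t) ≤ ∏ t (λ _ → E) * ℕ→ℚ (t !)
  t^t≤E^t*t! E zero    _    = ≤-refl
  t^t≤E^t*t! E (suc t) E-ok = begin
    ℕ→ℚ (suc t ℕ.* suc t ^ t)                 ≡⟨ ℕ→ℚ-* (suc t) (suc t ^ t) ⟩
    c * ℕ→ℚ (suc t ^ t)                       ≤⟨ c*-mono (E-ok (ℕₚ.n<1+n t)) ⟩
    c * (E * ℕ→ℚ (t ^ t))                     ≤⟨ c*-mono (*-monoˡ-≤-nonNeg E ih) ⟩
    c * (E * (Eᵗ * ℕ→ℚ (t !)))                ≡⟨ rearrange c E Eᵗ (ℕ→ℚ (t !)) ⟩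
    E * Eᵗ * (c * ℕ→ℚ (t !))                  ≡⟨ cong (E * Eᵗ *_) (ℕ→ℚ-* (suc t) (t !)) ⟨
    E * Eᵗ * ℕ→ℚ (suc t ℕ.* t !)              ∎
    where
    open ≤-Reasoning
    c = ℕ→ℚ (suc t)
    Eᵗ = ∏ t (λ _ → E)
    c*-mono = *-monoˡ-≤-nonNeg c {{ℕ→ℚ-nonNeg (suc t)}}
    ih = t^t≤E^t*t! E t (E-ok ∘ ℕₚ.m<n⇒m<1+n)
    rearrange : ∀ c e p f → c * (e * (p * f)) ≡ e * p * (c * f)
    rearrange = solve 4 (λ c e p f → c :* (e :* (p :* f)) := e :* p :* (c :* f)) refl

  [n∸s]!*n^s≤eApprox[s]^s*n! : ∀ {s n} → s ℕ.≤ n →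
                               ℕ→ℚ ((n ℕ.∸ s) ! ℕ.* n ^ s) ≤ ∏ s (λ _ → eApprox s) * ℕ→ℚ (n !)
  [n∸s]!*n^s≤eApprox[s]^s*n! {s} {n} s≤n =
    *-cancelʳ-≤-pos (ℕ→ℚ (s !)) {{ℕ→ℚ-pos (s !) {{s !≢0}}}} (begin
      ℕ→ℚ ((n ℕ.∸ s) ! ℕ.* n ^ s) * ℕ→ℚ (s !)   ≡⟨ ℕ→ℚ-* ((n ℕ.∸ s) ! ℕ.* n ^ s) (s !) ⟨
      ℕ→ℚ ((n ℕ.∸ s) ! ℕ.* n ^ s ℕ.* s !)      ≤⟨ ℕ→ℚ-mono-≤ ([n∸s]!*n^s*s!≤s^s*n! s≤n) ⟩
      ℕ→ℚ (s ^ s ℕ.* n !)                      ≡⟨ ℕ→ℚ-* (s ^ s) (n !) ⟩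
      ℕ→ℚ (s ^ s) * ℕ→ℚ (n !)                  ≤⟨ *-monoʳ-≤-nonNeg _ {{ℕ→ℚ-nonNeg (n !)}} s^s≤Eˢ*s! ⟩
      Eˢ * ℕ→ℚ (s !) * ℕ→ℚ (n !)               ≡⟨ swap Eˢ (ℕ→ℚ (s !)) (ℕ→ℚ (n !)) ⟩
      Eˢ * ℕ→ℚ (n !) * ℕ→ℚ (s !)               ∎)
    where
    open ≤-Reasoning
    Eˢ = ∏ s (λ _ → eApprox s)
    [1+j]^j≤eApprox[s]*j^j : ∀ {j} → j ℕ.< s → ℕ→ℚ ((1 ℕ.+ j) ^ j) ≤ eApprox s * ℕ→ℚ (j ^ j)
    [1+j]^j≤eApprox[s]*j^j {j} j<s = ≤-trans ([1+t]^t≤eApprox[1+t]*t^t j)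
      (*-monoʳ-≤-nonNeg (ℕ→ℚ (j ^ j)) {{ℕ→ℚ-nonNeg (j ^ j)}} (eApprox-mono-≤′ (ℕₚ.≤⇒≤′ j<s)))
    s^s≤Eˢ*s! : ℕ→ℚ (s ^ s) ≤ Eˢ * ℕ→ℚ (s !)
    s^s≤Eˢ*s! = t^t≤E^t*t! (eApprox s) {{eApprox-nonNeg s}} s [1+j]^j≤eApprox[s]*j^j
    swap : ∀ e a b → e * a * b ≡ e * b * a
    swap = solve 3 (λ e a b → e :* a :* b := e :* b :* a) refl

  prob*n^s≤eApprox[s]^s*∏∣L∣ : ∀ {n s} → s ℕ.≤ n → (L : Fin s → Subset n) (x : Fin s → Fin n) →
    Injective _≡_ _≡_ x →
    prob x L * ℕ→ℚ (n ^ s) ≤ ∏ s (λ _ → eApprox s) * ℕ→ℚ (product (λ i → ∣ L i ∣))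
  prob*n^s≤eApprox[s]^s*∏∣L∣ {n} {s} s≤n L x x-inj = begin
    ℕ→ℚ (#event x L) * inv (#perms n) * ℕ→ℚ (n ^ s)
      ≡⟨ cong (λ m → ℕ→ℚ (#event x L) * inv m * ℕ→ℚ (n ^ s)) (#perms≡n! n) ⟩
    ℕ→ℚ (#event x L) * inv (n !) * ℕ→ℚ (n ^ s)
      ≡⟨ trans (swap (ℕ→ℚ (#event x L)) (inv (n !)) (ℕ→ℚ (n ^ s)))
               (cong (_* inv (n !)) (sym (ℕ→ℚ-* (#event x L) (n ^ s)))) ⟩
    ℕ→ℚ (#event x L ℕ.* n ^ s) * inv (n !)
      ≤⟨ *inv[n!]-mono (ℕ→ℚ-mono-≤ #event*n^s≤P*[n∸s]!*n^s) ⟩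
    ℕ→ℚ (P ℕ.* ((n ℕ.∸ s) ! ℕ.* n ^ s)) * inv (n !)
      ≡⟨ cong (_* inv (n !)) (ℕ→ℚ-* P ((n ℕ.∸ s) ! ℕ.* n ^ s)) ⟩
    ℕ→ℚ P * ℕ→ℚ ((n ℕ.∸ s) ! ℕ.* n ^ s) * inv (n !)
      ≤⟨ *inv[n!]-mono (*-monoˡ-≤-nonNeg (ℕ→ℚ P) {{ℕ→ℚ-nonNeg P}} ([n∸s]!*n^s≤eApprox[s]^s*n! s≤n)) ⟩
    ℕ→ℚ P * (Eˢ * ℕ→ℚ (n !)) * inv (n !)
      ≡⟨ rearrange (ℕ→ℚ P) Eˢ (ℕ→ℚ (n !)) (inv (n !)) ⟩
    Eˢ * ℕ→ℚ P * (inv (n !) * ℕ→ℚ (n !))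
      ≡⟨ cong (Eˢ * ℕ→ℚ P *_) (inv-cancel (n !) {{n !≢0}}) ⟩
    Eˢ * ℕ→ℚ P * 1ℚ
      ≡⟨ *-identityʳ (Eˢ * ℕ→ℚ P) ⟩
    Eˢ * ℕ→ℚ P ∎
    where
    open ≤-Reasoning
    P = product (λ i → ∣ L i ∣)
    Eˢ = ∏ s (λ _ → eApprox s)
    *inv[n!]-mono = *-monoʳ-≤-nonNeg (inv (n !)) {{inv-nonNeg (n !)}}
    #event*n^s≤P*[n∸s]!*n^s : #event x L ℕ.* n ^ s ℕ.≤ P ℕ.* ((n ℕ.∸ s) ! ℕ.* n ^ s)
    #event*n^s≤P*[n∸s]!*n^s = ℕₚ.≤-trans (ℕₚ.*-monoˡ-≤ (n ^ s) (#event-≤ x L x-inj))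
                                         (ℕₚ.≤-reflexive (ℕₚ.*-assoc P ((n ℕ.∸ s) !) (n ^ s)))
    swap : ∀ a b c → a * b * c ≡ a * c * b
    swap = solve 3 (λ a b c → a :* b :* c := a :* c :* b) refl
    rearrange : ∀ p e f i → p * (e * f) * i ≡ e * p * (i * f)
    rearrange = solve 4 (λ p e f i → p :* (e :* f) :* i := e :* p :* (i :* f)) refl

  n^s≢0 : ∀ {s n} → s ℕ.≤ n → ℕ.NonZero (n ^ s)
  n^s≢0 {zero}          _ = _
  n^s≢0 {suc s} {suc m} _ = ℕₚ.m^n≢0 (suc m) (suc s)

open RationalBounds
  using (ℕ→ℚ-pos; p≤p+q; ∏[E*f*inv[n]]*ℕ→ℚ[n^s]; prob*n^s≤eApprox[s]^s*∏∣L∣; n^s≢0)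
open import Data.Nat using (ℕ; _≤_; _^_; +-*-rawSemiring)
open import Data.Fin using (Fin)
open import Data.Fin.Subset using (Subset; ∣_∣)
open import Data.Product using (∃; _,_)
open import Data.Rational using (ℚ; 0ℚ; _<_; _+_; _*_) renaming (_≤_ to _≤ℚ_)
open import Data.Rational.Properties using (≤-trans; <⇒≤; *-cancelʳ-≤-pos; module ≤-Reasoning)
open import Function.Definitions using (Injective)
open import Relation.Binary.PropositionalEquality using (_≡_)
open import Algebra.Definitions.RawSemiring +-*-rawSemiring using (product)

lemma2p5 : (n s : ℕ) → s ≤ n → (L : Fin s → Subset n) → (x : Fin s → Fin n) → Injective _≡_ _≡_ x
         → (ε : ℚ) → 0ℚ < ε
         → ∃ λ N → prob x L ≤ℚ ∏ s (λ i → eApprox N * ℕ→ℚ ∣ L i ∣ * inv n) + ε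
lemma2p5 n s s≤n L x x-inj ε ε>0 = s , ≤-trans prob≤R (p≤p+q (<⇒≤ ε>0))
  where
  open ≤-Reasoning
  R = ∏ s (λ i → eApprox s * ℕ→ℚ ∣ L i ∣ * inv n)
  -- The partial sum E_s already bounds the probability.
  prob≤R : prob x L ≤ℚ R
  prob≤R = *-cancelʳ-≤-pos (ℕ→ℚ (n ^ s)) {{ℕ→ℚ-pos (n ^ s) {{n^s≢0 s≤n}}}} (begin
    prob x L * ℕ→ℚ (n ^ s)
      ≤⟨ prob*n^s≤eApprox[s]^s*∏∣L∣ s≤n L x x-inj ⟩
    ∏ s (λ _ → eApprox s) * ℕ→ℚ (product (λ i → ∣ L i ∣))
      ≡⟨ ∏[E*f*inv[n]]*ℕ→ℚ[n^s] (eApprox s) (λ i → ∣ L i ∣) s≤n ⟨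
    R * ℕ→ℚ (n ^ s) ∎)
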